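{- Let $C\in\mathbb{B}^{\ell\times m}$ and $D\in\mathbb{B}^{\ell\times n}$ form an easy pair of matrices. Then for all $\bar M\in\mathbb{N}^m,\bar N\in\mathbb{N}^n$: there exists a complete $(C,D)$-biregular graph of size $(\bar M,\bar N)$ if and only if there exists a $(C,D)$-biregular graph of size $(\bar M,\bar N)$.
   Context: $\mathbb{B}=\mathbb{N}\cup\{{\ge}d\mid d\in\mathbb{N}\}$, "$x={\ge}d$" meaning $x\ge d$. $(C,D)$ is an easy pair if for every $i\in\{1,\dots,m\}$ and $j\in\{1,\dots,n\}$ there is $l\in\{1,\dots,\ell\}$ with both $C_{l,i}$ and $D_{l,j}$ of the form ${\ge}k$. An $\ell$-type bipartite graph is $G=(U,V,E_1,\dots,E_\ell)$ with pairwise disjoint $E_i\subseteq U\times V$; $\deg_{E_i}(u)$ is the number of $E_i$-edges at $u$. $G$ is $(C,D)$-biregular of size $(\bar M,\bar N)$ if there are partitions $U=U_1\cup\dots\cup U_m$, $V=V_1\cup\dots\cup V_n$ with $(|U_1|,\dots,|U_m|)=\bar M$, $(|V_1|,\dots,|V_n|)=\bar N$, $\deg_{E_i}(u)=C_{i,j}$ for $u\in U_j$ and $\deg_{E_i}(v)=D_{i,j}$ for $v\in V_j$; it is complete if $U\times V=E_1\cup\dots\cup E_\ell$. -}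

module Defs where

open import Data.Nat using (ℕ; zero; suc; _+_; _≥_)
open import Data.Fin using (Fin; zero; suc)
open import Data.Bool using (Bool; true; false; if_then_else_)
open import Data.Maybe using (Maybe; just; nothing; Is-just)
open import Data.Product using (Σ; _×_; ∃-syntax)
open import Relation.Binary.PropositionalEquality using (_≡_)
open import Relation.Nullary.Decidable using (⌊_⌋)
import Data.Fin.Properties as FinP
open import Data.Empty using (⊥)
open import Data.Unit using (⊤)

data 𝔹 : Set where
  exactly : ℕ → 𝔹
  atLeast : ℕ → 𝔹

_≐_ : ℕ → 𝔹 → Set
x ≐ exactly d = x ≡ d
x ≐ atLeast d = x ≥ d

IsGe : 𝔹 → Set
IsGe (exactly _) = ⊥
IsGe (atLeast _) = ⊤

Matrix : ℕ → ℕ → Set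
Matrix ℓ m = Fin ℓ → Fin m → 𝔹

EasyPair : ∀ {ℓ m n} → Matrix ℓ m → Matrix ℓ n → Set
EasyPair {ℓ} {m} {n} C D =
  (i : Fin m) (j : Fin n) → ∃[ l ] (IsGe (C l i) × IsGe (D l j))

count : ∀ {k} → (Fin k → Bool) → ℕ
count {zero} P = 0
count {suc k} P = (if P zero then 1 else 0) + count (λ x → P (suc x))

_==_ : ∀ {k} → Fin k → Fin k → Bool
a == b = ⌊ a FinP.≟ b ⌋

-- An ℓ-type bipartite graph with U = Fin p, V = Fin q: each pair (u,v) lies in
-- at most one E_i (pairwise disjointness), recorded as  E u v = just i,
-- or in none of them (E u v = nothing).
Graph : ℕ → ℕ → ℕ → Set
Graph ℓ p q = Fin p → Fin q → Maybe (Fin ℓ)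

inE : ∀ {ℓ} → Fin ℓ → Maybe (Fin ℓ) → Bool
inE i (just k) = i == k
inE i nothing = false

degU : ∀ {ℓ p q} → Graph ℓ p q → Fin ℓ → Fin p → ℕ
degU G i u = count (λ v → inE i (G u v))

degV : ∀ {ℓ p q} → Graph ℓ p q → Fin ℓ → Fin q → ℕ
degV G i v = count (λ u → inE i (G u v))

Complete : ∀ {ℓ p q} → Graph ℓ p q → Set
Complete {p = p} {q} G = (u : Fin p) (v : Fin q) → Is-just (G u v)

-- G is (C,D)-biregular of size (M̄,N̄), witnessed by partitions of U and V
-- given as part-assignment maps cU : U → Fin m, cV : V → Fin n.
IsBiregular : ∀ {ℓ m n p q} → Matrix ℓ m → Matrix ℓ n →
              (Fin m → ℕ) → (Fin n → ℕ) → Graph ℓ p q → Set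
IsBiregular {ℓ} {m} {n} {p} {q} C D M N G =
  Σ (Fin p → Fin m) λ cU → Σ (Fin q → Fin n) λ cV →
    ((j : Fin m) → count (λ u → cU u == j) ≡ M j) ×
    ((j : Fin n) → count (λ v → cV v == j) ≡ N j) ×
    ((i : Fin ℓ) (u : Fin p) → degU G i u ≐ C i (cU u)) ×
    ((i : Fin ℓ) (v : Fin q) → degV G i v ≐ D i (cV v))

∃Biregular : ∀ {ℓ m n} → Matrix ℓ m → Matrix ℓ n → (Fin m → ℕ) → (Fin n → ℕ) → Set
∃Biregular {ℓ} C D M N =
  Σ ℕ λ p → Σ ℕ λ q → Σ (Graph ℓ p q) λ G → IsBiregular C D M N G

∃CompleteBiregular : ∀ {ℓ m n} → Matrix ℓ m → Matrix ℓ n → (Fin m → ℕ) → (Fin n → ℕ) → Set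
∃CompleteBiregular {ℓ} C D M N =
  Σ ℕ λ p → Σ ℕ λ q → Σ (Graph ℓ p q) λ G → Complete G × IsBiregular C D M N G

-- A biregular graph is completed by putting every missing pair (u, v) into a
-- type l with C l (cU u) and D l (cV v) both of the form ≥k, which the easy-pair
-- condition provides. This only raises degrees, and only degrees that are
-- constrained from below, so the completed graph is still (C, D)-biregular.
module Submission where

open import Defs
open import Data.Nat using (ℕ; zero; suc; _≤_; _+_; z≤n; s≤s)
open import Data.Nat.Properties using (≤-trans; m≤n⇒m≤1+n)
open import Data.Fin using (Fin; zero; suc)
import Data.Fin.Properties as FinP
open import Data.Bool using (Bool; true; false)
open import Data.Maybe using (Maybe; just; nothing; _<∣>_)
import Data.Maybe.Relation.Unary.Any as Maybe
open import Data.Product using (_×_; _,_; proj₁; proj₂)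
open import Data.Unit using (tt)
open import Data.Empty using (⊥-elim)
open import Function using (_∘′_)
open import Function.Bundles using (_⇔_; mk⇔)
open import Relation.Binary.PropositionalEquality using (_≡_; _≢_; refl; sym; subst; cong)
open import Relation.Nullary using (¬_; yes; no)

count-cong : ∀ {k} {P Q : Fin k → Bool} → (∀ x → P x ≡ Q x) → count P ≡ count Q
count-cong {zero} P≡Q = refl
count-cong {suc k} P≡Q rewrite P≡Q zero = cong (_ +_) (count-cong (λ x → P≡Q (suc x)))

count-mono : ∀ {k} {P Q : Fin k → Bool} → (∀ x → P x ≡ true → Q x ≡ true) → count P ≤ count Q
count-mono {zero} P⇒Q = z≤n
count-mono {suc k} {P} {Q} P⇒Q with P zero | Q zero | P⇒Q zero
... | true  | true  | _    = s≤s (count-mono (λ x → P⇒Q (suc x)))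
... | true  | false | P⇒Q₀ with () ← P⇒Q₀ refl
... | false | true  | _    = m≤n⇒m≤1+n (count-mono (λ x → P⇒Q (suc x)))
... | false | false | _    = count-mono (λ x → P⇒Q (suc x))

inE-<∣>ˡ : ∀ {ℓ} (i : Fin ℓ) x y → inE i x ≡ true → inE i (x <∣> y) ≡ true
inE-<∣>ˡ i (just k) y i∈x = i∈x

inE-<∣>-just-≢ : ∀ {ℓ} {i l : Fin ℓ} x → i ≢ l → inE i (x <∣> just l) ≡ inE i x
inE-<∣>-just-≢ (just k) i≢l = refl
inE-<∣>-just-≢ {i = i} {l} nothing i≢l with i FinP.≟ l
... | yes i≡l = ⊥-elim (i≢l i≡l)
... | no _    = refl

≐-grow : ∀ {x y} b → x ≐ b → x ≤ y → (¬ IsGe b → y ≡ x) → y ≐ b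
≐-grow (exactly d) x≡d x≤y y≡x = subst (_≡ d) (sym (y≡x λ ())) x≡d
≐-grow (atLeast d) d≤x x≤y y≡x = ≤-trans d≤x x≤y

-- r is one row (or column) of a graph, t the types used to fill its gaps, and
-- b i the constraint on the number of E_i-edges in it.
fillRow-≐ : ∀ {ℓ k} (r : Fin k → Maybe (Fin ℓ)) (t : Fin k → Fin ℓ) (b : Fin ℓ → 𝔹) →
            (∀ x → IsGe (b (t x))) → (∀ i → count (λ x → inE i (r x)) ≐ b i) →
            ∀ i → count (λ x → inE i (r x <∣> just (t x))) ≐ b i
fillRow-≐ r t b t-atLeast r≐b i =
  ≐-grow (b i) (r≐b i)
    (count-mono (λ x → inE-<∣>ˡ i (r x) (just (t x))))
    (λ bᵢ-exact → count-cong λ x →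
       inE-<∣>-just-≢ (r x) λ i≡tx → bᵢ-exact (subst (IsGe ∘′ b) (sym i≡tx) (t-atLeast x)))

completeWith : ∀ {ℓ p q} → Graph ℓ p q → (Fin p → Fin q → Fin ℓ) → Graph ℓ p q
completeWith G L u v = G u v <∣> just (L u v)

completeWith-complete : ∀ {ℓ p q} (G : Graph ℓ p q) L → Complete (completeWith G L)
completeWith-complete G L u v with G u v
... | just _  = Maybe.just tt
... | nothing = Maybe.just tt

biregular⇒completeBiregular : ∀ {ℓ m n} {C : Matrix ℓ m} {D : Matrix ℓ n} {M N} →
                              EasyPair C D → ∃Biregular C D M N → ∃CompleteBiregular C D M N
biregular⇒completeBiregular {C = C} {D} easy (p , q , G , cU , cV , |U| , |V| , degU≐C , degV≐D) =
  p , q , completeWith G L , completeWith-complete G L , cU , cV , |U| , |V| ,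
  (λ i u → fillRow-≐ (G u) (L u) (λ i → C i (cU u))
             (λ v → proj₁ (proj₂ (easy (cU u) (cV v)))) (λ i → degU≐C i u) i) ,
  (λ i v → fillRow-≐ (λ u → G u v) (λ u → L u v) (λ i → D i (cV v))
             (λ u → proj₂ (proj₂ (easy (cU u) (cV v)))) (λ i → degV≐D i v) i)
  where
  L : Fin p → Fin q → Fin _
  L u v = proj₁ (easy (cU u) (cV v))

lemma5 : (ℓ m n : ℕ) (C : Matrix ℓ m) (D : Matrix ℓ n) → EasyPair C D →
         (M : Fin m → ℕ) (N : Fin n → ℕ) →
         ∃CompleteBiregular C D M N ⇔ ∃Biregular C D M N
lemma5 _ _ _ _ _ easy _ _ =
  mk⇔ (λ (p , q , G , _ , biregular) → p , q , G , biregular)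
      (biregular⇒completeBiregular easy)
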